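{- Let $t$ be a nonnegative integer and let $B_t$ be the basis of the class $P_t$ of permutations of tier at most $t$. Then every $\sigma\in B_t$ has length at most $3(t+1)$.
   Context: Multi-pass stack sorting: in a pass, the entries of the current input are pushed one at a time, in order, onto a stack; whenever the top of the stack is the smallest value not yet output, it is popped to the output (repeatedly); entries are never popped otherwise. When all input entries have been pushed and no pop is possible, if the stack is nonempty the remaining entries are returned to the input in their original relative order and a new pass begins. The tier of a permutation is one less than the minimum number of passes needed to output $1,\dots,n$. The set $P_t$ of permutations of tier at most $t$ is closed under pattern containment; its basis $B_t$ is the set of permutations not in $P_t$ all of whose proper patterns (subpermutations) lie in $P_t$, so that $P_t$ is exactly the set of permutations avoiding every element of $B_t$. -}

module Defs where

open import Data.Nat using (ℕ; zero; suc; _+_; _<_; _≡ᵇ_)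
open import Data.Bool using (if_then_else_)
open import Data.Product using (_×_; _,_; proj₁; proj₂)
open import Data.List using (List; []; _∷_; length; map; upTo; reverse; lookup)
open import Data.List.Relation.Binary.Permutation.Propositional using (_↭_)
open import Data.List.Relation.Binary.Sublist.Propositional using (_⊆_)
open import Data.Fin using (Fin; cast)
open import Function.Bundles using (_⇔_)
open import Relation.Binary.PropositionalEquality using (_≡_)
open import Relation.Nullary using (¬_)

IsPerm : List ℕ → Set
IsPerm σ = σ ↭ map suc (upTo (length σ))

OrderIso : List ℕ → List ℕ → Set
OrderIso xs ys =
  Data.Product.Σ (length xs ≡ length ys) λ eq →
    ∀ (i j : Fin (length xs)) →
      (lookup xs i < lookup xs j) ⇔ (lookup ys (cast eq i) < lookup ys (cast eq j))

_≼_ : List ℕ → List ℕ → Set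
τ ≼ σ = Data.Product.Σ (List ℕ) λ s → (s ⊆ σ) × OrderIso τ s

-- Popping: stack given top-first; m is the smallest value not yet output.
popAll : ℕ → List ℕ → ℕ × List ℕ
popAll m [] = m , []
popAll m (y ∷ ys) = if y ≡ᵇ m then popAll (suc m) ys else (m , y ∷ ys)

-- One pass: push input entries one by one, popping whenever possible.
-- At the end the remaining stack (top-first) is returned to the input
-- in original relative order, i.e. reversed.
passAux : ℕ → List ℕ → List ℕ → ℕ × List ℕ
passAux m [] st = m , reverse st
passAux m (x ∷ xs) st with popAll m (x ∷ st)
... | m' , st' = passAux m' xs st'

pass : ℕ × List ℕ → ℕ × List ℕ
pass (m , xs) = passAux m xs []

-- k passes, starting from state (next value to output, current input).
passes : ℕ → ℕ × List ℕ → ℕ × List ℕ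
passes zero s = s
passes (suc k) s = passes k (pass s)

-- σ has tier at most t: t+1 passes (starting with 1 as the next value
-- to output) suffice to output everything.
InP : ℕ → List ℕ → Set
InP t σ = IsPerm σ × (proj₂ (passes (suc t) (1 , σ)) ≡ [])

InBasis : ℕ → List ℕ → Set
InBasis t σ =
  IsPerm σ × ¬ InP t σ ×
  (∀ τ → IsPerm τ → τ ≼ σ → length τ < length σ → InP t τ)

-- If a pass started with next value m does not finish the job, it stops at a value k′ that is
-- still on the stack under a larger entry c, and the entry b whose push triggered the last run of
-- pops is smaller: k′ c b is an occurrence of 231 with b ≥ m. Deleting an entry x outside this
-- occurrence (and standardising) keeps it, so the pass on the smaller permutation stops no later.
-- Iterating over t+1 passes, at most 3(t+1) entries certify that σ needs more than t+1 passes; if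
-- σ were longer, deleting any other entry would give a proper pattern of σ outside P_t.

module Submission where

open import Defs
open import Data.Bool using (true; false)
open import Data.Empty using (⊥-elim)
open import Data.Fin using (Fin; cast) renaming (zero to fzero; suc to fsuc)
open import Data.List
  using (List; []; _∷_; _++_; [_]; length; map; filter; reverse; upTo; applyUpTo; lookup)
open import Data.List.Properties
  using (filter-++; filter-accept; filter-reject; filter-all; filter-none; reverse-++; reverse-involutive;
         ++-identityʳ; ++-assoc; length-map; map-upTo; reverse-injective)
open import Data.List.Membership.Propositional using (_∈_; _∉_)
open import Data.List.Membership.Propositional.Properties
  using (∈-filter⁺; ∈-filter⁻; ∈-++⁻; ∈-++⁺ˡ; ∈-++⁺ʳ; ∈-map⁺; ∈-∃++; ∈-lookup)
open import Data.List.Relation.Unary.All as All using (All; []; _∷_)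
open import Data.List.Relation.Unary.All.Properties using (all-filter; ¬Any⇒All¬) renaming (++⁻ to All-++⁻)
open import Data.List.Relation.Unary.Any using (here; there)
import Data.List.Relation.Unary.Any.Properties as Any
open import Data.List.Relation.Unary.Unique.Propositional using (Unique; []; _∷_)
import Data.List.Relation.Unary.Unique.Propositional.Properties as Unique
open import Data.List.Relation.Binary.Permutation.Propositional using (_↭_; ↭-sym; ↭⇒↭ₛ)
open import Data.List.Relation.Binary.Permutation.Propositional.Properties
  using (∈-resp-↭; ↭-reverse; filter-↭; ↭-length)
import Data.List.Relation.Binary.Permutation.Propositional.Properties as ↭
import Data.List.Relation.Binary.Permutation.Setoid.Properties as ↭ₛ
open import Data.List.Relation.Binary.Sublist.Propositional
  using (_⊆_; []; _∷_; _∷ʳ_; ⊆-refl; ⊆-trans; from∈) renaming (lookup to ⊆-lookup)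
open import Data.List.Relation.Binary.Sublist.Propositional.Properties
  using (filter-⊆; filter⁺; ++⁺; ++⁺ʳ; reverse⁺; reverse⁻)
  renaming (map⁺ to ⊆-map⁺)
open import Data.Nat
  using (ℕ; zero; suc; pred; _+_; _*_; _∸_; _≤_; _<_; _≟_; _≤?_; _<?_; _≡ᵇ_; z≤n; s≤s)
open import Data.Nat.Properties
open import Data.List.Membership.DecPropositional Data.Nat._≟_ using (_∈?_)
open import Data.Product using (∃₂; ∃-syntax; _×_; _,_; proj₁; proj₂)
open import Data.Sum using (_⊎_; inj₁; inj₂)
open import Data.Unit using (⊤; tt)
open import Function using (_∘_)
open import Function.Bundles using (mk⇔)
open import Relation.Binary.PropositionalEquality
  using (_≡_; _≢_; refl; sym; trans; cong; cong₂; subst; subst₂; setoid; module ≡-Reasoning)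
open import Relation.Nullary using (¬_; yes; no; ¬?)
open import Relation.Unary using (Decidable)

range : ℕ → ℕ → List ℕ
range k zero    = []
range k (suc j) = k ∷ range (suc k) j

range-bounds : ∀ k j → All (λ v → k ≤ v × v < k + j) (range k j)
range-bounds k zero    = []
range-bounds k (suc j) =
  (≤-refl , subst (k <_) (sym (+-suc k j)) (s≤s (m≤m+n k j))) ∷
  All.map (λ { {v} (k<v , v<) → <⇒≤ k<v , subst (v <_) (sym (+-suc k j)) v< }) (range-bounds (suc k) j)

∈-range : ∀ {k j v} → k ≤ v → v < k + j → v ∈ range k j
∈-range {k} {zero}  k≤v v<k+0 = ⊥-elim (<⇒≱ v<k+0 (subst (_≤ _) (sym (+-identityʳ k)) k≤v))
∈-range {k} {suc j} {v} k≤v v< with k ≟ v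
... | yes refl = here refl
... | no k≢v   = there (∈-range (≤∧≢⇒< k≤v k≢v) (subst (v <_) (+-suc k j) v<))

length-range : ∀ k j → length (range k j) ≡ j
length-range k zero    = refl
length-range k (suc j) = cong suc (length-range (suc k) j)

Unique-range : ∀ k j → Unique (range k j)
Unique-range k zero    = []
Unique-range k (suc j) = All.map (λ (k<v , _) → <⇒≢ k<v) (range-bounds (suc k) j) ∷ Unique-range (suc k) j

applyUpTo≡range : ∀ j k (f : ℕ → ℕ) → (∀ i → f i ≡ k + i) → applyUpTo f j ≡ range k j
applyUpTo≡range zero    k f f≗ = refl
applyUpTo≡range (suc j) k f f≗ =
  cong₂ _∷_ (trans (f≗ 0) (+-identityʳ k))
            (applyUpTo≡range j (suc k) (λ i → f (suc i)) (λ i → trans (f≗ (suc i)) (+-suc k i)))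

map-suc-upTo≡range : ∀ n → map suc (upTo n) ≡ range 1 n
map-suc-upTo≡range n = trans (map-upTo suc n) (applyUpTo≡range n 1 suc (λ _ → refl))

above : ℕ → List ℕ → List ℕ
above k = filter (k ≤?_)

above-accept : ∀ {k x} xs → k ≤ x → above k (x ∷ xs) ≡ x ∷ above k xs
above-accept {k} xs = filter-accept (k ≤?_)

above-reject : ∀ {k x} xs → ¬ k ≤ x → above k (x ∷ xs) ≡ above k xs
above-reject {k} xs = filter-reject (k ≤?_)

above-[x] : ∀ {k x} → k ≤ x → above k [ x ] ≡ [ x ]
above-[x] = above-accept []

All-above : ∀ k xs → All (k ≤_) (above k xs)
All-above k = all-filter (k ≤?_)

above-⊆ : ∀ k xs → above k xs ⊆ xs
above-⊆ k = filter-⊆ (k ≤?_)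

∈-above⁺ : ∀ {k v xs} → v ∈ xs → k ≤ v → v ∈ above k xs
∈-above⁺ {k} = ∈-filter⁺ (k ≤?_)

∈-above⁻ : ∀ {k v} xs → v ∈ above k xs → v ∈ xs × k ≤ v
∈-above⁻ {k} xs = ∈-filter⁻ (k ≤?_) {xs = xs}

above-above : ∀ {k l} xs → k ≤ l → above l (above k xs) ≡ above l xs
above-above []       k≤l = refl
above-above {k} {l} (x ∷ xs) k≤l with k ≤? x | l ≤? x
... | yes k≤x | yes l≤x rewrite above-accept xs k≤x | above-accept (above k xs) l≤x | above-accept xs l≤x =
  cong (x ∷_) (above-above xs k≤l)
... | yes k≤x | no  l≰x rewrite above-accept xs k≤x | above-reject (above k xs) l≰x | above-reject xs l≰x =
  above-above xs k≤l
... | no  k≰x | _       rewrite above-reject xs k≰x | above-reject xs (λ l≤x → k≰x (≤-trans k≤l l≤x)) =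
  above-above xs k≤l

above-snoc : ∀ k xs x → above k (xs ++ [ x ]) ≡ above k xs ++ above k [ x ]
above-snoc k xs x = filter-++ (k ≤?_) xs [ x ]

reverse-above : ∀ k xs → reverse (above k xs) ≡ above k (reverse xs)
reverse-above k []       = refl
reverse-above k (x ∷ xs) = begin
  reverse (above k (x ∷ xs))                      ≡⟨ cong reverse (filter-++ (k ≤?_) [ x ] xs) ⟩
  reverse (above k [ x ] ++ above k xs)           ≡⟨ reverse-++ (above k [ x ]) (above k xs) ⟩
  reverse (above k xs) ++ reverse (above k [ x ]) ≡⟨ cong₂ _++_ (reverse-above k xs) reverse-above-[x] ⟩
  above k (reverse xs) ++ above k [ x ]           ≡⟨ above-snoc k (reverse xs) x ⟨
  above k (reverse xs ++ [ x ])                   ≡⟨ cong (above k) (reverse-++ [ x ] xs) ⟨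
  above k (reverse (x ∷ xs))                      ∎
  where
  open ≡-Reasoning
  reverse-above-[x] : reverse (above k [ x ]) ≡ above k [ x ]
  reverse-above-[x] with k ≤? x
  ... | yes k≤x rewrite above-[x] k≤x = refl
  ... | no  k≰x rewrite above-reject {k} [] k≰x = refl

Unique-above : ∀ k {xs} → Unique xs → Unique (above k xs)
Unique-above k = Unique.filter⁺ (k ≤?_)

Unique-resp-↭ : ∀ {xs ys : List ℕ} → xs ↭ ys → Unique xs → Unique ys
Unique-resp-↭ p = ↭ₛ.Unique-resp-↭ (setoid ℕ) (↭⇒↭ₛ p)

Unique-reverse : ∀ {xs : List ℕ} → Unique xs → Unique (reverse xs)
Unique-reverse {xs} = Unique-resp-↭ (↭-sym (↭-reverse xs))

Unique-++⁻ˡ : ∀ (xs : List ℕ) {ys} → Unique (xs ++ ys) → Unique xs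
Unique-++⁻ˡ []       _          = []
Unique-++⁻ˡ (x ∷ xs) (x∉ ∷ xs!) = proj₁ (All-++⁻ xs x∉) ∷ Unique-++⁻ˡ xs xs!

Unique-++⇒disjoint : ∀ (xs : List ℕ) {ys v} → Unique (xs ++ ys) → v ∈ xs → v ∉ ys
Unique-++⇒disjoint (x ∷ xs) (x∉ ∷ _) (here refl) v∈ys =
  All.lookup (proj₂ (All-++⁻ xs x∉)) v∈ys refl
Unique-++⇒disjoint (x ∷ xs) (_ ∷ xs!) (there v∈xs) = Unique-++⇒disjoint xs xs! v∈xs

∈-reverse⁺ : ∀ {v} {xs : List ℕ} → v ∈ xs → v ∈ reverse xs
∈-reverse⁺ = Any.reverse⁺

∈-reverse⁻ : ∀ {v} {xs : List ℕ} → v ∈ reverse xs → v ∈ xs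
∈-reverse⁻ = Any.reverse⁻

⊆-filter : ∀ {P : ℕ → Set} (P? : Decidable P) {xs ys} → xs ⊆ ys → All P xs → xs ⊆ filter P? ys
⊆-filter P? xs⊆ys Pxs = subst (_⊆ _) (filter-all P? Pxs) (filter⁺ P? P? (λ { refl p → p }) xs⊆ys)

popAll-hit : ∀ m ys → popAll m (m ∷ ys) ≡ popAll (suc m) ys
popAll-hit m ys with m ≡ᵇ m | ≡⇒≡ᵇ m m refl
... | true | _ = refl

popAll-miss : ∀ {m y} ys → y ≢ m → popAll m (y ∷ ys) ≡ (m , y ∷ ys)
popAll-miss {m} {y} ys y≢m with y ≡ᵇ m | ≡ᵇ⇒≡ y m
... | false | _    = refl
... | true  | y≡m = ⊥-elim (y≢m (y≡m tt))

NotOnTop : ℕ → List ℕ → Set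
NotOnTop k []      = ⊤
NotOnTop k (y ∷ _) = y ≢ k

popAll-run : ∀ m st → ∃[ j ] proj₁ (popAll m st) ≡ m + j
                           × st ≡ range m j ++ proj₂ (popAll m st)
                           × NotOnTop (proj₁ (popAll m st)) (proj₂ (popAll m st))
popAll-run m []       = 0 , sym (+-identityʳ m) , refl , tt
popAll-run m (y ∷ ys) with y ≟ m
... | yes refl rewrite popAll-hit m ys with popAll-run (suc m) ys
...   | j , k′≡ , ys≡ , top = suc j , trans k′≡ (sym (+-suc m j)) , cong (m ∷_) ys≡ , top
popAll-run m (y ∷ ys) | no y≢m rewrite popAll-miss ys y≢m = 0 , sym (+-identityʳ m) , refl , y≢m

passAux-∷ : ∀ k x xs st → passAux k (x ∷ xs) st ≡ passAux (proj₁ (popAll k (x ∷ st))) xs (proj₂ (popAll k (x ∷ st)))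
passAux-∷ k x xs st with popAll k (x ∷ st)
... | _ = refl

popped-stack : ∀ k j zs st → Unique zs → reverse (above k zs) ≡ range k j ++ st → st ≡ reverse (above (k + j) zs)
popped-stack k j zs st zs! stack≡ = sym (begin
  reverse (above (k + j) zs)                   ≡⟨ cong reverse (above-above zs (m≤m+n k j)) ⟨
  reverse (above (k + j) (above k zs))         ≡⟨ reverse-above (k + j) (above k zs) ⟩
  above (k + j) (reverse (above k zs))         ≡⟨ cong (above (k + j)) stack≡ ⟩
  above (k + j) (range k j ++ st)              ≡⟨ filter-++ ((k + j) ≤?_) (range k j) st ⟩
  above (k + j) (range k j) ++ above (k + j) st ≡⟨ cong₂ _++_ run-dropped st-kept ⟩
  st                                           ∎)
  where
  open ≡-Reasoning
  run-dropped : above (k + j) (range k j) ≡ []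
  run-dropped = filter-none ((k + j) ≤?_) (All.map (λ (_ , v<) → <⇒≱ v<) (range-bounds k j))
  run++st! : Unique (range k j ++ st)
  run++st! = subst Unique stack≡ (Unique-reverse (Unique-above k zs!))
  ≥k+j : ∀ {v} → v ∈ st → k + j ≤ v
  ≥k+j {v} v∈st with (k + j) ≤? v
  ... | yes k+j≤v = k+j≤v
  ... | no  k+j≰v = ⊥-elim (Unique-++⇒disjoint (range k j) run++st! (∈-range k≤v (≰⇒> k+j≰v)) v∈st)
    where
    k≤v : k ≤ v
    k≤v = proj₂ (∈-above⁻ zs (∈-reverse⁻ (subst (v ∈_) (sym stack≡) (∈-++⁺ʳ (range k j) v∈st))))
  st-kept : above (k + j) st ≡ st
  st-kept = filter-all ((k + j) ≤?_) (All.tabulate ≥k+j)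

-- A pass from m₀ after pushing the prefix ys: k is the smallest value not yet output and st the
-- stack, top first.
record PassInvariant (m₀ : ℕ) (ys : List ℕ) (k : ℕ) (st : List ℕ) : Set where
  field
    stack  : st ≡ reverse (above k ys)
    start≤ : m₀ ≤ k
    output : ∀ {v} → m₀ ≤ v → v < k → v ∈ ys
open PassInvariant

invariant-[] : ∀ m₀ → PassInvariant m₀ [] m₀ []
invariant-[] m₀ = record { stack = refl ; start≤ = ≤-refl ; output = λ m₀≤v v<m₀ → ⊥-elim (<⇒≱ v<m₀ m₀≤v) }

push-stack : ∀ {k x st} ys → k ≤ x → st ≡ reverse (above k ys) → x ∷ st ≡ reverse (above k (ys ++ [ x ]))
push-stack {k} {x} {st} ys k≤x stack≡ = begin
  x ∷ st                                ≡⟨ cong (x ∷_) stack≡ ⟩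
  x ∷ reverse (above k ys)              ≡⟨ reverse-++ (above k ys) [ x ] ⟨
  reverse (above k ys ++ [ x ])         ≡⟨ cong (λ l → reverse (above k ys ++ l)) (above-[x] k≤x) ⟨
  reverse (above k ys ++ above k [ x ]) ≡⟨ cong reverse (above-snoc k ys x) ⟨
  reverse (above k (ys ++ [ x ]))       ∎
  where open ≡-Reasoning

record PushResult (m₀ : ℕ) (ys : List ℕ) (x k : ℕ) (st : List ℕ) : Set where
  field
    pushed   : x ∷ st ≡ reverse (above k (ys ++ [ x ]))
    popped   : PassInvariant m₀ (ys ++ [ x ]) (proj₁ (popAll k (x ∷ st))) (proj₂ (popAll k (x ∷ st)))
    next≤x   : k ≤ x
    top      : NotOnTop (proj₁ (popAll k (x ∷ st))) (proj₂ (popAll k (x ∷ st)))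
    pop⇒next : proj₁ (popAll k (x ∷ st)) ≢ k → x ≡ k
open PushResult

push : ∀ {m₀ ys x k st} → PassInvariant m₀ ys k st → Unique (ys ++ [ x ]) → m₀ ≤ x → PushResult m₀ ys x k st
push {m₀} {ys} {x} {k} {st} I ys∷x! m₀≤x = record
  { pushed   = pushed≡
  ; popped   = record { stack = stack′ ; start≤ = ≤-trans (start≤ I) k≤k′ ; output = output′ }
  ; next≤x   = k≤x
  ; top      = top′
  ; pop⇒next = pop⇒next′ j k′≡ run≡
  }
  where
  k≤x : k ≤ x
  k≤x with k ≤? x
  ... | yes k≤x = k≤x
  ... | no  k≰x = ⊥-elim (Unique-++⇒disjoint ys ys∷x! (output I m₀≤x (≰⇒> k≰x)) (here refl))
  pushed≡ : x ∷ st ≡ reverse (above k (ys ++ [ x ]))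
  pushed≡ = push-stack ys k≤x (stack I)
  j = proj₁ (popAll-run k (x ∷ st))
  k′≡ = proj₁ (proj₂ (popAll-run k (x ∷ st)))
  run≡ = proj₁ (proj₂ (proj₂ (popAll-run k (x ∷ st))))
  top′ = proj₂ (proj₂ (proj₂ (popAll-run k (x ∷ st))))
  k′ = proj₁ (popAll k (x ∷ st))
  k≤k′ : k ≤ k′
  k≤k′ = subst (k ≤_) (sym k′≡) (m≤m+n k j)
  stack′ : proj₂ (popAll k (x ∷ st)) ≡ reverse (above k′ (ys ++ [ x ]))
  stack′ = subst (λ l → proj₂ (popAll k (x ∷ st)) ≡ reverse (above l (ys ++ [ x ]))) (sym k′≡)
             (popped-stack k j (ys ++ [ x ]) _ ys∷x! (trans (sym pushed≡) run≡))
  output′ : ∀ {v} → m₀ ≤ v → v < k′ → v ∈ ys ++ [ x ]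
  output′ {v} m₀≤v v<k′ with v <? k
  ... | yes v<k = ∈-++⁺ˡ (output I m₀≤v v<k)
  ... | no  v≮k = proj₁ (∈-above⁻ (ys ++ [ x ]) (∈-reverse⁻ (subst (v ∈_) (trans (sym run≡) pushed≡)
                    (∈-++⁺ˡ (∈-range (≮⇒≥ v≮k) (subst (v <_) k′≡ v<k′))))))
  pop⇒next′ : ∀ j {st′} → k′ ≡ k + j → x ∷ st ≡ range k j ++ st′ → k′ ≢ k → x ≡ k
  pop⇒next′ zero    k′≡k+0 _    k′≢k = ⊥-elim (k′≢k (trans k′≡k+0 (+-identityʳ k)))
  pop⇒next′ (suc j) _      refl _    = refl

module PassInduction
  (m₀ : ℕ) (xs : List ℕ) (xs! : Unique xs) (m₀≤xs : All (m₀ ≤_) xs)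
  (Q : List ℕ → ℕ → Set)
  (Q-push : ∀ {ys x k st} → PassInvariant m₀ ys k st → Unique (ys ++ [ x ]) → PushResult m₀ ys x k st →
            Q ys k → Q (ys ++ [ x ]) (proj₁ (popAll k (x ∷ st))))
  where

  Final : ℕ × List ℕ → Set
  Final (k , rest) = PassInvariant m₀ xs k (reverse rest) × Q xs k

  run : ∀ zs ys k st → ys ++ zs ≡ xs → PassInvariant m₀ ys k st → Q ys k → Final (passAux k zs st)
  run [] ys k st ys≡ I q =
    subst (λ l → PassInvariant m₀ l k _) ys≡′ (subst (PassInvariant m₀ ys k) (sym (reverse-involutive st)) I) ,
    subst (λ l → Q l k) ys≡′ q
    where ys≡′ = trans (sym (++-identityʳ ys)) ys≡
  run (z ∷ zs) ys k st ys≡ I q rewrite passAux-∷ k z zs st =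
    run zs (ys ++ [ z ]) _ _ ys∷z≡ (popped R) (Q-push I ys∷z! R q)
    where
    ys∷z≡ : (ys ++ [ z ]) ++ zs ≡ xs
    ys∷z≡ = trans (++-assoc ys [ z ] zs) ys≡
    ys∷z! : Unique (ys ++ [ z ])
    ys∷z! = Unique-++⁻ˡ (ys ++ [ z ]) (subst Unique (sym ys∷z≡) xs!)
    R = push I ys∷z! (All.lookup m₀≤xs (subst (z ∈_) ys≡ (∈-++⁺ʳ ys (here refl))))

  run-pass : Q [] m₀ → Final (passAux m₀ xs [])
  run-pass q = run xs [] m₀ [] refl (invariant-[] m₀) q

startAt : ℕ → List ℕ → ℕ × List ℕ
startAt m xs = m , above m xs

next : ℕ → List ℕ → ℕ
next m xs = proj₁ (pass (startAt m xs))

Stuck : ℕ → ℕ × List ℕ → Set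
Stuck k s = proj₂ (passes k s) ≢ []

pass-startAt : ∀ {m xs} → Unique xs → m ≤ next m xs × pass (startAt m xs) ≡ startAt (next m xs) xs
pass-startAt {m} {xs} xs!
  with I , _ ← PassInduction.run-pass m (above m xs) (Unique-above m xs!) (All-above m xs) (λ _ _ → ⊤) (λ _ _ _ _ → tt) tt
  = start≤ I , cong (next m xs ,_) (trans (reverse-injective (stack I)) (above-above xs (start≤ I)))

passes-startAt : ∀ k {m xs} → Unique xs → passes (suc k) (startAt m xs) ≡ passes k (startAt (next m xs) xs)
passes-startAt k xs! = cong (passes k) (proj₂ (pass-startAt xs!))

passes-[] : ∀ k m → proj₂ (passes k (m , [])) ≡ []
passes-[] zero    m = refl
passes-[] (suc k) m = passes-[] k m

Stuck⇒nonempty : ∀ k {m xs} → Stuck k (m , xs) → xs ≢ []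
Stuck⇒nonempty k {m} stuck refl = stuck (passes-[] k m)

triple-⊆-snoc⁻ : ∀ {a c b x : ℕ} ys → (a ∷ c ∷ b ∷ []) ⊆ ys ++ [ x ] →
                 (a ∷ c ∷ b ∷ []) ⊆ ys ⊎ (b ≡ x × (a ∷ c ∷ []) ⊆ ys)
triple-⊆-snoc⁻ {x = x} ys abc⊆ with subst (_ ⊆_) (reverse-++ ys [ x ]) (reverse⁺ abc⊆)
... | _    ∷ʳ cba⊆ = inj₁ (reverse⁻ cba⊆)
... | refl ∷  ca⊆  = inj₂ (refl , reverse⁻ ca⊆)

popAll-blocked : ∀ {a c} k st → Unique st → (c ∷ a ∷ []) ⊆ st → k ≤ a → a < c → proj₁ (popAll k st) ≤ a
popAll-blocked k (y ∷ st) st! ca⊆ k≤a a<c with y ≟ k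
popAll-blocked k (.k ∷ st) (k∉ ∷ st!) (.k ∷ʳ ca⊆) k≤a a<c | yes refl rewrite popAll-hit k st =
  popAll-blocked (suc k) st st! ca⊆ (≤∧≢⇒< k≤a (All.lookup k∉ (⊆-lookup ca⊆ (there (here refl))))) a<c
popAll-blocked k (.k ∷ st) _ (refl ∷ _) k≤a a<c | yes refl = ⊥-elim (<⇒≱ a<c k≤a)
popAll-blocked k (y ∷ st) _ _ k≤a _ | no y≢k rewrite popAll-miss st y≢k = k≤a

next≤231 : ∀ {m xs a c b} → Unique xs → (a ∷ c ∷ b ∷ []) ⊆ xs → m ≤ b → b < a → a < c → next m xs ≤ a
next≤231 {m} {xs} {a} {c} {b} xs! acb⊆ m≤b b<a a<c =
  proj₂ (PassInduction.run-pass m (above m xs) (Unique-above m xs!) (All-above m xs) Q Q-push (λ ()))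
        (⊆-filter (m ≤?_) acb⊆ (m≤a ∷ ≤-trans m≤a (<⇒≤ a<c) ∷ m≤b ∷ []))
  where
  m≤a = ≤-trans m≤b (<⇒≤ b<a)
  Q : List ℕ → ℕ → Set
  Q ys k = (a ∷ c ∷ b ∷ []) ⊆ ys → k ≤ a
  Q-push : ∀ {ys x k st} → PassInvariant m ys k st → Unique (ys ++ [ x ]) → PushResult m ys x k st →
           Q ys k → Q (ys ++ [ x ]) (proj₁ (popAll k (x ∷ st)))
  Q-push {ys} {x} {k} {st} I ys∷x! R q acb⊆ys∷x =
    popAll-blocked k (x ∷ st) stack! (subst ((c ∷ a ∷ []) ⊆_) (sym (pushed R)) ca⊆stack) k≤a a<c
    where
    k≤a×ac⊆ys : k ≤ a × (a ∷ c ∷ []) ⊆ ys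
    k≤a×ac⊆ys with triple-⊆-snoc⁻ ys acb⊆ys∷x
    ... | inj₁ acb⊆ys         = q acb⊆ys , ⊆-trans (refl ∷ refl ∷ (b ∷ʳ [])) acb⊆ys
    ... | inj₂ (refl , ac⊆ys) = ≤-trans (next≤x R) (<⇒≤ b<a) , ac⊆ys
    k≤a = proj₁ k≤a×ac⊆ys
    stack! : Unique (x ∷ st)
    stack! = subst Unique (sym (pushed R)) (Unique-reverse (Unique-above k ys∷x!))
    ca⊆stack : (c ∷ a ∷ []) ⊆ reverse (above k (ys ++ [ x ]))
    ca⊆stack = reverse⁺ (⊆-filter (k ≤?_) (++⁺ʳ [ x ] (proj₂ k≤a×ac⊆ys)) (k≤a ∷ ≤-trans k≤a (<⇒≤ a<c) ∷ []))

popAll-pops-pushed : ∀ k st → k < proj₁ (popAll k (k ∷ st))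
popAll-pops-pushed k st rewrite popAll-hit k st
  with j , k′≡ , _ ← popAll-run (suc k) st = subst (k <_) (sym k′≡) (s≤s (m≤m+n k j))

below-top : ∀ {k st} zs → st ≡ reverse (above k zs) → NotOnTop k st → k ∈ st →
            ∃[ y ] (k ∷ y ∷ []) ⊆ above k zs × k < y
below-top zs st≡ top (here refl) = ⊥-elim (top refl)
below-top {k} {y ∷ rest} zs st≡ top (there k∈rest) = y , reverse⁻ yk⊆ , ≤∧≢⇒< k≤y (λ k≡y → top (sym k≡y))
  where
  yk⊆ : (y ∷ k ∷ []) ⊆ reverse (above k zs)
  yk⊆ = subst ((y ∷ k ∷ []) ⊆_) st≡ (refl ∷ from∈ k∈rest)
  k≤y : k ≤ y
  k≤y = proj₂ (∈-above⁻ zs (∈-reverse⁻ (subst (y ∈_) st≡ (here refl))))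

next∈⇒231 : ∀ {m xs} → Unique xs → next m xs ∈ xs →
            ∃₂ λ c b → (next m xs ∷ c ∷ b ∷ []) ⊆ xs × m ≤ b × b < next m xs × next m xs < c
next∈⇒231 {m} {xs} xs! next∈xs =
  weaken (proj₂ (PassInduction.run-pass m (above m xs) (Unique-above m xs!) (All-above m xs) Q Q-push (λ ()))
                (∈-above⁺ next∈xs (proj₁ (pass-startAt xs!))))
  where
  Witness : List ℕ → ℕ → Set
  Witness ys k = ∃₂ λ c b → (k ∷ c ∷ b ∷ []) ⊆ ys × m ≤ b × b < k × k < c
  Q : List ℕ → ℕ → Set
  Q ys k = k ∈ ys → Witness ys k
  Q-push : ∀ {ys x k st} → PassInvariant m ys k st → Unique (ys ++ [ x ]) → PushResult m ys x k st →
           Q ys k → Q (ys ++ [ x ]) (proj₁ (popAll k (x ∷ st)))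
  Q-push {ys} {x} {k} {st} I ys∷x! R q k′∈ with proj₁ (popAll k (x ∷ st)) ≟ k
  ... | yes k′≡k = subst (Witness (ys ++ [ x ])) (sym k′≡k) (earlier (∈-++⁻ ys (subst (_∈ ys ++ [ x ]) k′≡k k′∈)))
    where
    earlier : k ∈ ys ⊎ k ∈ [ x ] → Witness (ys ++ [ x ]) k
    earlier (inj₁ k∈ys) with c , b , kcb⊆ , rest ← q k∈ys = c , b , ++⁺ʳ [ x ] kcb⊆ , rest
    earlier (inj₂ (here refl)) = ⊥-elim (<⇒≢ (popAll-pops-pushed k st) (sym k′≡k))
  ... | no  k′≢k with refl ← pop⇒next R k′≢k
    = y , x , ++⁺ (⊆-trans k′y⊆ (above-⊆ _ ys)) (⊆-refl {x = [ x ]}) , start≤ I , x<k′ , k′<y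
    where
    k′ = proj₁ (popAll x (x ∷ st))
    x<k′ : x < k′
    x<k′ = popAll-pops-pushed x st
    k′∈stack : k′ ∈ proj₂ (popAll x (x ∷ st))
    k′∈stack = subst (k′ ∈_) (sym (stack (popped R))) (∈-reverse⁺ (∈-above⁺ k′∈ ≤-refl))
    above-pushed : above k′ (ys ++ [ x ]) ≡ above k′ ys
    above-pushed = trans (above-snoc k′ ys x) (trans (cong (above k′ ys ++_) (above-reject [] (<⇒≱ x<k′))) (++-identityʳ _))
    witness = below-top (ys ++ [ x ]) (stack (popped R)) (top R) k′∈stack
    y = proj₁ witness
    k′y⊆ : (k′ ∷ y ∷ []) ⊆ above k′ ys
    k′y⊆ = subst ((k′ ∷ y ∷ []) ⊆_) above-pushed (proj₁ (proj₂ witness))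
    k′<y = proj₂ (proj₂ witness)
  weaken : ∀ {k} → Witness (above m xs) k → Witness xs k
  weaken (c , b , kcb⊆ , rest) = c , b , ⊆-trans kcb⊆ (above-⊆ m xs) , rest

-- Standardisation after deleting the value x: the values above x move down by one.
squeeze : ℕ → ℕ → ℕ
squeeze x y with y ≤? x
... | yes _ = y
... | no  _ = pred y

squeeze-≤ : ∀ {x y} → y ≤ x → squeeze x y ≡ y
squeeze-≤ {x} {y} y≤x with y ≤? x
... | yes _   = refl
... | no  y≰x = ⊥-elim (y≰x y≤x)

squeeze-> : ∀ {x y} → x < y → squeeze x y ≡ pred y
squeeze-> {x} {y} x<y with y ≤? x
... | yes y≤x = ⊥-elim (<⇒≱ x<y y≤x)
... | no  _   = refl

squeeze-mono-≤ : ∀ x {y z} → y ≤ z → squeeze x y ≤ squeeze x z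
squeeze-mono-≤ x {y} {z} y≤z with y ≤? x | z ≤? x
... | yes _   | yes _   = y≤z
... | yes y≤x | no  z≰x = ≤-trans y≤x (<⇒≤pred (≰⇒> z≰x))
... | no  y≰x | yes z≤x = ⊥-elim (y≰x (≤-trans y≤z z≤x))
... | no  _   | no  _   = pred-mono-≤ y≤z

squeeze-mono-< : ∀ {x y z} → x ≢ y → y < z → squeeze x y < squeeze x z
squeeze-mono-< {x} {y} {z} x≢y y<z with y ≤? x | z ≤? x
... | yes _   | yes _   = y<z
... | yes y≤x | no  z≰x = <-≤-trans (≤∧≢⇒< y≤x (λ y≡x → x≢y (sym y≡x))) (<⇒≤pred (≰⇒> z≰x))
... | no  y≰x | yes z≤x = ⊥-elim (y≰x (≤-trans (<⇒≤ y<z) z≤x))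
... | no  y≰x | no  _   with y | z | y<z
...   | zero   | _      | _       = ⊥-elim (y≰x z≤n)
...   | suc _  | suc _  | s≤s y<z′ = y<z′

squeeze-cancel-< : ∀ x {y z} → squeeze x y < squeeze x z → y < z
squeeze-cancel-< x {y} {z} sy<sz with y <? z
... | yes y<z = y<z
... | no  y≮z = ⊥-elim (<⇒≱ sy<sz (squeeze-mono-≤ x (≮⇒≥ y≮z)))

remove : ℕ → List ℕ → List ℕ
remove x = filter (λ y → ¬? (x ≟ y))

infixl 25 _∖_
_∖_ : List ℕ → ℕ → List ℕ
σ ∖ x = map (squeeze x) (remove x σ)

remove-range-below : ∀ {x} a n → x < a → remove x (range a n) ≡ range a n
remove-range-below {x} a n x<a =
  filter-all (λ y → ¬? (x ≟ y)) (All.map (λ (a≤y , _) → <⇒≢ (<-≤-trans x<a a≤y)) (range-bounds a n))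

squeeze-range-above : ∀ {x} a n → x < a → map (squeeze x) (range a n) ≡ range (pred a) n
squeeze-range-above a       zero    x<a = refl
squeeze-range-above (suc a) (suc n) x<a =
  cong₂ _∷_ (squeeze-> x<a) (squeeze-range-above (suc (suc a)) n (≤-trans x<a (n≤1+n _)))

range-∖ : ∀ {x} a n → a ≤ x → x < a + n → range a n ∖ x ≡ range a (n ∸ 1)
range-∖ {x} a zero    a≤x x<a+0 = ⊥-elim (<⇒≱ x<a+0 (subst (_≤ x) (sym (+-identityʳ a)) a≤x))
range-∖ {x} a (suc n) a≤x x< with x ≟ a
... | yes refl rewrite filter-reject (λ y → ¬? (x ≟ y)) {x} {range (suc x) n} (λ x≢x → x≢x refl)
  = trans (cong (map (squeeze x)) (remove-range-below (suc x) n ≤-refl)) (squeeze-range-above (suc x) n ≤-refl)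
... | no x≢a rewrite filter-accept (λ y → ¬? (x ≟ y)) {a} {range (suc a) n} x≢a with n
...   | zero   = ⊥-elim (<⇒≱ x< (subst (_≤ x) (sym (+-comm a 1)) (≤∧≢⇒< a≤x (λ a≡x → x≢a (sym a≡x)))))
...   | suc n′ = cong₂ _∷_ (squeeze-≤ a≤x)
                   (range-∖ (suc a) (suc n′) (≤∧≢⇒< a≤x (λ a≡x → x≢a (sym a≡x))) (subst (x <_) (+-suc a (suc n′)) x<))

⊆-∖ : ∀ {x l} σ → l ⊆ σ → All (x ≢_) l → map (squeeze x) l ⊆ σ ∖ x
⊆-∖ {x} σ l⊆σ x∉l = ⊆-map⁺ (squeeze x) (⊆-filter (λ y → ¬? (x ≟ y)) l⊆σ x∉l)

lookup-map : ∀ (f : ℕ → ℕ) xs (i : Fin (length (map f xs))) →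
             lookup (map f xs) i ≡ f (lookup xs (cast (length-map f xs) i))
lookup-map f (y ∷ ys) fzero    = refl
lookup-map f (y ∷ ys) (fsuc i) = lookup-map f ys i

map-OrderIso : ∀ (f : ℕ → ℕ) xs → (∀ {y z} → y ∈ xs → y < z → f y < f z) → (∀ {y z} → f y < f z → y < z) →
               OrderIso (map f xs) xs
map-OrderIso f xs f-mono f-cancel = length-map f xs , λ i j →
  mk⇔ (λ fy<fz → f-cancel (subst₂ _<_ (lookup-map f xs i) (lookup-map f xs j) fy<fz))
      (λ y<z → subst₂ _<_ (sym (lookup-map f xs i)) (sym (lookup-map f xs j)) (f-mono (∈-lookup _) y<z))

∖-≼ : ∀ x σ → σ ∖ x ≼ σ
∖-≼ x σ = remove x σ , filter-⊆ (λ y → ¬? (x ≟ y)) σ ,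
  map-OrderIso (squeeze x) (remove x σ)
    (λ y∈ → squeeze-mono-< (proj₂ (∈-filter⁻ (λ y → ¬? (x ≟ y)) {xs = σ} y∈)))
    (squeeze-cancel-< x)

IsPerm⇒↭range : ∀ {σ} → IsPerm σ → σ ↭ range 1 (length σ)
IsPerm⇒↭range {σ} σ↭ = subst (σ ↭_) (map-suc-upTo≡range (length σ)) σ↭

IsPerm⇒Unique : ∀ {σ} → IsPerm σ → Unique σ
IsPerm⇒Unique {σ} σ↭ = Unique-resp-↭ (↭-sym (IsPerm⇒↭range σ↭)) (Unique-range 1 (length σ))

IsPerm-∈⁻ : ∀ {σ v} → IsPerm σ → v ∈ σ → 1 ≤ v × v ≤ length σ
IsPerm-∈⁻ σ↭ v∈σ with 1≤v , v<1+n ← All.lookup (range-bounds 1 _) (∈-resp-↭ (IsPerm⇒↭range σ↭) v∈σ) =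
  1≤v , ≤-pred v<1+n

IsPerm-∈⁺ : ∀ {σ v} → IsPerm σ → 1 ≤ v → v ≤ length σ → v ∈ σ
IsPerm-∈⁺ σ↭ 1≤v v≤n = ∈-resp-↭ (↭-sym (IsPerm⇒↭range σ↭)) (∈-range 1≤v (s≤s v≤n))

startAt-1 : ∀ {σ} → IsPerm σ → startAt 1 σ ≡ (1 , σ)
startAt-1 σ↭ = cong (1 ,_) (filter-all (1 ≤?_) (All.tabulate (λ v∈σ → proj₁ (IsPerm-∈⁻ σ↭ v∈σ))))

∖-↭range : ∀ {σ x} → IsPerm σ → x ∈ σ → σ ∖ x ↭ range 1 (length σ ∸ 1)
∖-↭range {σ} {x} σ↭ x∈σ with 1≤x , x≤n ← IsPerm-∈⁻ σ↭ x∈σ =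
  subst (σ ∖ x ↭_) (range-∖ 1 (length σ) 1≤x (s≤s x≤n))
        (↭.map⁺ (squeeze x) (filter-↭ (λ y → ¬? (x ≟ y)) (IsPerm⇒↭range σ↭)))

length-∖ : ∀ {σ x} → IsPerm σ → x ∈ σ → length (σ ∖ x) ≡ length σ ∸ 1
length-∖ σ↭ x∈σ = trans (↭-length (∖-↭range σ↭ x∈σ)) (length-range 1 _)

∖-shorter : ∀ {σ x} → IsPerm σ → x ∈ σ → length (σ ∖ x) < length σ
∖-shorter {_ ∷ _} σ↭ x∈σ = subst (_< _) (sym (length-∖ σ↭ x∈σ)) ≤-refl

IsPerm-∖ : ∀ {σ x} → IsPerm σ → x ∈ σ → IsPerm (σ ∖ x)
IsPerm-∖ {σ} {x} σ↭ x∈σ =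
  subst (λ n → σ ∖ x ↭ map suc (upTo n)) (sym (length-∖ σ↭ x∈σ))
        (subst (σ ∖ x ↭_) (sym (map-suc-upTo≡range _)) (∖-↭range σ↭ x∈σ))

Unique-∖ : ∀ {σ x} → IsPerm σ → x ∈ σ → Unique (σ ∖ x)
Unique-∖ σ↭ x∈σ = IsPerm⇒Unique (IsPerm-∖ σ↭ x∈σ)

Stuck-next : ∀ k {m xs} → Unique xs → Stuck (suc k) (startAt m xs) → Stuck k (startAt (next m xs) xs)
Stuck-next k xs! = subst (λ s → proj₂ s ≢ []) (passes-startAt k xs!)

Stuck-prev : ∀ k {m xs} → Unique xs → Stuck k (startAt (next m xs) xs) → Stuck (suc k) (startAt m xs)
Stuck-prev k xs! = subst (λ s → proj₂ s ≢ []) (sym (passes-startAt k xs!))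

Stuck⇒∉P : ∀ {t σ} → IsPerm σ → Stuck (suc t) (startAt 1 σ) → ¬ InP t σ
Stuck⇒∉P {t} σ↭ stuck (_ , sorted) = stuck (subst (λ s → proj₂ (passes (suc t) s) ≡ []) (sym (startAt-1 σ↭)) sorted)

∉P⇒Stuck : ∀ {t σ} → IsPerm σ → ¬ InP t σ → Stuck (suc t) (startAt 1 σ)
∉P⇒Stuck {t} σ↭ σ∉P sorted = σ∉P (σ↭ , subst (λ s → proj₂ (passes (suc t) s) ≡ []) (startAt-1 σ↭) sorted)

∈⇒nonempty : ∀ {v} {xs : List ℕ} → v ∈ xs → xs ≢ []
∈⇒nonempty (here _)  ()
∈⇒nonempty (there _) ()

nonempty⇒∈ : ∀ {xs : List ℕ} → xs ≢ [] → ∃[ v ] v ∈ xs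
nonempty⇒∈ {[]}    xs≢[] = ⊥-elim (xs≢[] refl)
nonempty⇒∈ {v ∷ _} _     = v , here refl

next-∖≤ : ∀ {σ x a c b m s} → IsPerm σ → x ∈ σ → (a ∷ c ∷ b ∷ []) ⊆ σ → All (x ≢_) (a ∷ c ∷ b ∷ []) →
          m ≤ b → b < a → a < c → s ≤ squeeze x m → next s (σ ∖ x) ≤ squeeze x a
next-∖≤ {σ} {x} σ↭ x∈σ acb⊆ x∉@(x≢a ∷ _ ∷ x≢b ∷ []) m≤b b<a a<c s≤ =
  next≤231 (Unique-∖ σ↭ x∈σ) (⊆-∖ σ acb⊆ x∉) (≤-trans s≤ (squeeze-mono-≤ x m≤b))
           (squeeze-mono-< x≢b b<a) (squeeze-mono-< x≢a a<c)

length-insert : ∀ (W₁ W₂ : List ℕ) a → length (W₁ ++ a ∷ W₂) ≡ suc (length (W₁ ++ W₂))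
length-insert []       W₂ a = refl
length-insert (_ ∷ W₁) W₂ a = cong suc (length-insert W₁ W₂ a)

∈-insert⁻ : ∀ (W₁ : List ℕ) {W₂ a v} → v ∈ W₁ ++ a ∷ W₂ → v ≡ a ⊎ v ∈ W₁ ++ W₂
∈-insert⁻ []       (here v≡a)  = inj₁ v≡a
∈-insert⁻ []       (there v∈)  = inj₂ v∈
∈-insert⁻ (_ ∷ W₁) (here v≡w)  = inj₂ (here v≡w)
∈-insert⁻ (_ ∷ W₁) (there v∈) with ∈-insert⁻ W₁ v∈
... | inj₁ v≡a = inj₁ v≡a
... | inj₂ v∈′ = inj₂ (there v∈′)

pigeonhole : ∀ (xs W : List ℕ) → Unique xs → length W < length xs → ∃[ v ] v ∈ xs × v ∉ W
pigeonhole (a ∷ as) W (a∉as ∷ as!) |W|< with a ∈? W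
... | no  a∉W = a , here refl , a∉W
... | yes a∈W with W₁ , W₂ , refl ← ∈-∃++ a∈W
  with v , v∈as , v∉W₁W₂ ← pigeonhole as (W₁ ++ W₂) as! (≤-pred (subst (_< _) (length-insert W₁ W₂ a) |W|<))
  = v , there v∈as , v∉W
  where
  v∉W : v ∉ W₁ ++ a ∷ W₂
  v∉W v∈W with ∈-insert⁻ W₁ v∈W
  ... | inj₁ refl = All.lookup a∉as v∈as refl
  ... | inj₂ v∈′  = v∉W₁W₂ v∈′

module _ {σ : List ℕ} (σ↭ : IsPerm σ) where

  private
    σ! : Unique σ
    σ! = IsPerm⇒Unique σ↭

  Stuck⇒next∈ : ∀ k {m} → 1 ≤ m → Stuck (suc k) (startAt m σ) → next m σ ∈ σ
  Stuck⇒next∈ k {m} 1≤m stuck with y , y∈ ← nonempty⇒∈ (Stuck⇒nonempty k (Stuck-next k σ! stuck))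
    with y∈σ , next≤y ← ∈-above⁻ σ y∈
    = IsPerm-∈⁺ σ↭ (≤-trans 1≤m (proj₁ (pass-startAt σ!))) (≤-trans next≤y (proj₂ (IsPerm-∈⁻ σ↭ y∈σ)))

  BlockedWithout : ℕ → ℕ → List ℕ → Set
  BlockedWithout m a T = ∀ {x} → x ∈ σ → All (x ≢_) T → ∀ {s} → s ≤ squeeze x m → next s (σ ∖ x) ≤ squeeze x a

  StuckWithout : ℕ → ℕ → List ℕ → Set
  StuckWithout k m W = ∀ {x} → x ∈ σ → x ∉ W → ∀ {s} → s ≤ squeeze x m → Stuck k (startAt s (σ ∖ x))

  blocked-after-deletion : ∀ k {m} → 1 ≤ m → Stuck (suc k) (startAt m σ) →
                           ∃₂ λ c b → BlockedWithout m (next m σ) (next m σ ∷ c ∷ b ∷ [])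
  blocked-after-deletion k 1≤m stuck =
    let c , b , m′cb⊆ , m≤b , b<m′ , m′<c = next∈⇒231 σ! (Stuck⇒next∈ k 1≤m stuck)
    in  c , b , λ x∈σ x∉ → next-∖≤ σ↭ x∈σ m′cb⊆ x∉ m≤b b<m′ m′<c

  survives : ∀ k {m} → 1 ≤ m → Stuck (suc k) (startAt m σ) → ∃[ W ] length W ≤ 3 * suc k × StuckWithout (suc k) m W
  survives zero {m} 1≤m stuck = last-pass (blocked-after-deletion 0 1≤m stuck)
    where
    last-pass : (∃₂ λ c b → BlockedWithout m (next m σ) (next m σ ∷ c ∷ b ∷ [])) →
                ∃[ W ] length W ≤ 3 * 1 × StuckWithout 1 m W
    last-pass (c , b , bound) = next m σ ∷ c ∷ b ∷ [] , ≤-refl , λ {x} x∈σ x∉W {s} s≤ →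
      Stuck-prev 0 {s} {σ ∖ x} (Unique-∖ σ↭ x∈σ)
        (∈⇒nonempty (∈-above⁺ (∈-map⁺ (squeeze x) (∈-filter⁺ (λ y → ¬? (x ≟ y)) (Stuck⇒next∈ 0 1≤m stuck) (x∉W ∘ here)))
                              (bound x∈σ (¬Any⇒All¬ _ x∉W) s≤)))
  survives (suc k) {m} 1≤m stuck =
    one-more (blocked-after-deletion (suc k) 1≤m stuck)
             (survives k (≤-trans 1≤m (proj₁ (pass-startAt σ!))) (Stuck-next (suc k) σ! stuck))
    where
    one-more : (∃₂ λ c b → BlockedWithout m (next m σ) (next m σ ∷ c ∷ b ∷ [])) →
               (∃[ W ] length W ≤ 3 * suc k × StuckWithout (suc k) (next m σ) W) →
               ∃[ W ] length W ≤ 3 * suc (suc k) × StuckWithout (suc (suc k)) m W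
    one-more (c , b , bound) (W , |W|≤ , W-survives) =
      (next m σ ∷ c ∷ b ∷ []) ++ W ,
      subst (3 + length W ≤_) (sym (*-suc 3 (suc k))) (+-monoʳ-≤ 3 |W|≤) ,
      λ {x} x∈σ x∉ {s} s≤ → Stuck-prev (suc k) {s} {σ ∖ x} (Unique-∖ σ↭ x∈σ)
        (W-survives x∈σ (x∉ ∘ ∈-++⁺ʳ _) (bound x∈σ (¬Any⇒All¬ _ (x∉ ∘ ∈-++⁺ˡ)) s≤))

proposition3p1 : (t : ℕ) (σ : List ℕ) → InBasis t σ → length σ ≤ 3 * (t + 1)
proposition3p1 t σ (σ↭ , σ∉P , patterns∈P) = ≮⇒≥ λ long →
  let W , |W|≤ , W-survives = survives σ↭ t ≤-refl (∉P⇒Stuck {t} σ↭ σ∉P)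
      |W|<|σ| = ≤-<-trans |W|≤ (subst (λ n → 3 * n < length σ) (+-comm t 1) long)
      x , x∈σ , x∉W = pigeonhole σ W (IsPerm⇒Unique σ↭) |W|<|σ|
      σ∖x↭ = IsPerm-∖ σ↭ x∈σ
      1≤squeeze = ≤-reflexive (sym (squeeze-≤ (proj₁ (IsPerm-∈⁻ σ↭ x∈σ))))
  in  Stuck⇒∉P {t} σ∖x↭ (W-survives x∈σ x∉W 1≤squeeze)
                 (patterns∈P (σ ∖ x) σ∖x↭ (∖-≼ x σ) (∖-shorter σ↭ x∈σ))
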